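{- Let $l\ge1$ and let $r$ be odd with $1\le r\le 2l$. Let $\overline{\mathcal{B}}(1,2l;r)$ be the set of boards in $\mathcal{B}(1,2l;r)$ whose board partition $(\lambda_1,\lambda_2)$ satisfies $\lambda_1\ge\lambda_2$. Then $\overline{\mathcal{B}}(1,2l;r)$ contains exactly one board from each equivalence class of $\mathcal{B}(1,2l;r)$ under $G=\{R_0,R_{180}\}$.
   Context: A $1\times 2l$ grid has cells $1,\dots,2l$ from left to right; $\mathcal{B}(1,2l;r)$ is the set of all choices of exactly $r$ blocked cells. $R_0$ is the identity and $R_{180}$ sends cell $j$ to cell $2l+1-j$; equivalence classes are $G$-orbits. The board partition $(\lambda_1,\lambda_2)$ gives the numbers of blocked cells among cells $1..l$ and among cells $l+1..2l$. -}

module Defs where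

open import Data.Nat using (ℕ; _+_; _*_; _≥_)
open import Data.Bool using (Bool; true; false)
open import Data.Vec using (Vec; reverse; take; drop; count)
open import Data.Bool.Properties using (T?)
open import Data.Product using (_×_; Σ; ∃)
open import Data.Sum using (_⊎_)
open import Relation.Binary.PropositionalEquality using (_≡_)

-- A 1 × 2l board: cell j (1-indexed) is position j-1 in the vector;
-- true = blocked.
Board : ℕ → Set
Board l = Vec Bool (l + l)

blocked : ∀ {n} → Vec Bool n → ℕ
blocked = count T?

InB : ∀ (l r : ℕ) → Board l → Set
InB l r b = blocked b ≡ r

data G : Set where
  R0 R180 : G

act : ∀ {l} → G → Board l → Board l
act R0   b = b
act R180 b = reverse b

λ₁ : ∀ {l} → Board l → ℕ
λ₁ {l} b = blocked (take l b)

λ₂ : ∀ {l} → Board l → ℕ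
λ₂ {l} b = blocked (drop l b)

InBbar : ∀ (l r : ℕ) → Board l → Set
InBbar l r b = InB l r b × λ₁ {l} b ≥ λ₂ {l} b

SameOrbit : ∀ (l : ℕ) → Board l → Board l → Set
SameOrbit l b b' = ∃ λ (g : G) → act {l} g b ≡ b'

Odd : ℕ → Set
Odd r = ∃ λ k → r ≡ 1 + 2 * k

-- Reversing a board swaps its two halves, so R180 exchanges λ₁ and λ₂. Since
-- λ₁ + λ₂ = r is odd, λ₁ ≠ λ₂, so exactly one of b and R180 b has λ₁ ≥ λ₂.
module Submission where

open import Defs
open import Data.Nat using (ℕ; suc; _≤_; _+_; _*_; _≤?_)
open import Data.Nat.Properties using (+-identityʳ; even≢odd; ≤-antisym; ≰⇒>; <⇒≤)
open import Data.Bool using (Bool; true; false; if_then_else_)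
open import Data.Vec using (Vec; []; _∷_; _++_; _∷ʳ_; take; drop; reverse; count)
open import Data.Vec.Properties using (take++drop≡id; ++-injective; reverse-∷; reverse-++-eqFree; cast-is-id)
open import Data.Product using (_×_; ∃; _,_; proj₁; proj₂)
open import Data.Sum using (_⊎_; inj₁; inj₂)
open import Data.Empty using (⊥-elim)
open import Function using (id)
open import Relation.Nullary using (¬_; does; yes; no)
open import Relation.Unary using (Pred; Decidable)
open import Relation.Binary.PropositionalEquality using (_≡_; _≢_; refl; sym; trans; cong; subst₂; module ≡-Reasoning)

module _ {a p} {A : Set a} {P : Pred A p} (P? : Decidable P) where

  count-++ : ∀ {m n} (xs : Vec A m) (ys : Vec A n) →
             count P? (xs ++ ys) ≡ count P? xs + count P? ys
  count-++ []       ys = refl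
  count-++ (x ∷ xs) ys with does (P? x)
  ... | true  = cong suc (count-++ xs ys)
  ... | false = count-++ xs ys

  count-∷ʳ : ∀ {n} (xs : Vec A n) (x : A) → count P? (xs ∷ʳ x) ≡ count P? (x ∷ xs)
  count-∷ʳ []       x = refl
  count-∷ʳ (y ∷ xs) x rewrite count-∷ʳ xs x with does (P? x) | does (P? y)
  ... | true  | true  = refl
  ... | true  | false = refl
  ... | false | true  = refl
  ... | false | false = refl

  count-reverse : ∀ {n} (xs : Vec A n) → count P? (reverse xs) ≡ count P? xs
  count-reverse []       = refl
  count-reverse (x ∷ xs) = begin
    count P? (reverse (x ∷ xs))                                 ≡⟨ cong (count P?) (reverse-∷ x xs) ⟩
    count P? (reverse xs ∷ʳ x)                                  ≡⟨ count-∷ʳ (reverse xs) x ⟩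
    (if does (P? x) then suc else id) (count P? (reverse xs))   ≡⟨ cong (if does (P? x) then suc else id) (count-reverse xs) ⟩
    count P? (x ∷ xs)                                           ∎
    where open ≡-Reasoning

module _ {a} {A : Set a} where

  take-++ : ∀ {m n} (xs : Vec A m) (ys : Vec A n) → take m (xs ++ ys) ≡ xs
  take-++ {m} xs ys = proj₁ (++-injective (take m (xs ++ ys)) xs (take++drop≡id m (xs ++ ys)))

  drop-++ : ∀ {m n} (xs : Vec A m) (ys : Vec A n) → drop m (xs ++ ys) ≡ ys
  drop-++ {m} xs ys = proj₂ (++-injective (take m (xs ++ ys)) xs (take++drop≡id m (xs ++ ys)))

  reverse-++-halves : ∀ {n} (xs ys : Vec A n) → reverse (xs ++ ys) ≡ reverse ys ++ reverse xs
  reverse-++-halves xs ys = trans (sym (cast-is-id refl _)) (reverse-++-eqFree xs ys)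

  take-reverse : ∀ n (xs : Vec A (n + n)) → take n (reverse xs) ≡ reverse (drop n xs)
  take-reverse n xs with take n xs | drop n xs | take++drop≡id n xs
  ... | ys | zs | refl rewrite reverse-++-halves ys zs = take-++ (reverse zs) (reverse ys)

  drop-reverse : ∀ n (xs : Vec A (n + n)) → drop n (reverse xs) ≡ reverse (take n xs)
  drop-reverse n xs with take n xs | drop n xs | take++drop≡id n xs
  ... | ys | zs | refl rewrite reverse-++-halves ys zs = drop-++ (reverse zs) (reverse ys)

blocked-reverse : ∀ {n} (xs : Vec Bool n) → blocked (reverse xs) ≡ blocked xs
blocked-reverse = count-reverse _

blocked≡λ₁+λ₂ : ∀ l (b : Board l) → blocked b ≡ λ₁ {l} b + λ₂ {l} b
blocked≡λ₁+λ₂ l b = begin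
  blocked b                                   ≡⟨ cong blocked (take++drop≡id l b) ⟨
  blocked (take l b ++ drop l b)              ≡⟨ count-++ _ (take l b) (drop l b) ⟩
  blocked (take l b) + blocked (drop l b)     ∎
  where open ≡-Reasoning

λ₁-reverse : ∀ l (b : Board l) → λ₁ {l} (reverse b) ≡ λ₂ {l} b
λ₁-reverse l b = trans (cong blocked (take-reverse l b)) (blocked-reverse (drop l b))

λ₂-reverse : ∀ l (b : Board l) → λ₂ {l} (reverse b) ≡ λ₁ {l} b
λ₂-reverse l b = trans (cong blocked (drop-reverse l b)) (blocked-reverse (take l b))

sum-odd⇒≢ : ∀ {m n k} → m + n ≡ 1 + 2 * k → m ≢ n
sum-odd⇒≢ {m} {k = k} m+m≡odd refl =
  even≢odd m k (trans (cong (m +_) (+-identityʳ m)) m+m≡odd)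

λ₁≢λ₂ : ∀ l r (b : Board l) → Odd r → InB l r b → λ₁ {l} b ≢ λ₂ {l} b
λ₁≢λ₂ l r b (k , r≡odd) inb = sum-odd⇒≢ {k = k} (trans (sym (blocked≡λ₁+λ₂ l b)) (trans inb r≡odd))

λ₂≤λ₁-or-reversed : ∀ l (b : Board l) →
  λ₂ {l} b ≤ λ₁ {l} b ⊎ λ₂ {l} (reverse b) ≤ λ₁ {l} (reverse b)
λ₂≤λ₁-or-reversed l b with λ₂ {l} b ≤? λ₁ {l} b
... | yes λ₂≤λ₁ = inj₁ λ₂≤λ₁
... | no  λ₂≰λ₁ = inj₂ (subst₂ _≤_ (sym (λ₂-reverse l b)) (sym (λ₁-reverse l b)) (<⇒≤ (≰⇒> λ₂≰λ₁)))

λ₂≤λ₁-not-both : ∀ l (b : Board l) → λ₁ {l} b ≢ λ₂ {l} b →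
  λ₂ {l} b ≤ λ₁ {l} b → ¬ (λ₂ {l} (reverse b) ≤ λ₁ {l} (reverse b))
λ₂≤λ₁-not-both l b λ₁≢λ₂ λ₂≤λ₁ reversed =
  λ₁≢λ₂ (≤-antisym (subst₂ _≤_ (λ₂-reverse l b) (λ₁-reverse l b) reversed) λ₂≤λ₁)

proposition7p2 : (l r : ℕ) → 1 ≤ l → Odd r → 1 ≤ r → r ≤ l + l →
    (b : Board l) → InB l r b →
      (∃ λ (b' : Board l) → SameOrbit l b b' × InBbar l r b')
      × ((b₁ b₂ : Board l) → SameOrbit l b b₁ → InBbar l r b₁ →
           SameOrbit l b b₂ → InBbar l r b₂ → b₁ ≡ b₂)
proposition7p2 l r _ odd _ _ b inb = existence , uniqueness
  where
  inb-reverse : InB l r (reverse b)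
  inb-reverse = trans (blocked-reverse b) inb

  existence : ∃ λ (b' : Board l) → SameOrbit l b b' × InBbar l r b'
  existence with λ₂≤λ₁-or-reversed l b
  ... | inj₁ λ₂≤λ₁ = b , (R0 , refl) , inb , λ₂≤λ₁
  ... | inj₂ λ₂≤λ₁ = reverse b , (R180 , refl) , inb-reverse , λ₂≤λ₁

  not-both : InBbar l r b → ¬ InBbar l r (reverse b)
  not-both (_ , λ₂≤λ₁) (_ , reversed) = λ₂≤λ₁-not-both l b (λ₁≢λ₂ l r b odd inb) λ₂≤λ₁ reversed

  uniqueness : (b₁ b₂ : Board l) → SameOrbit l b b₁ → InBbar l r b₁ →
               SameOrbit l b b₂ → InBbar l r b₂ → b₁ ≡ b₂
  uniqueness _ _ (R0   , refl) _  (R0   , refl) _  = refl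
  uniqueness _ _ (R180 , refl) _  (R180 , refl) _  = refl
  uniqueness _ _ (R0   , refl) i₁ (R180 , refl) i₂ = ⊥-elim (not-both i₁ i₂)
  uniqueness _ _ (R180 , refl) i₁ (R0   , refl) i₂ = ⊥-elim (not-both i₂ i₁)
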